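{- Let $V$ be a finite-dimensional $\mathbb{Q}$-linear space, $d$ a positive integer, $\mathcal{I}$ a finite index set, and $\boldsymbol{a}_{1i},\ldots,\boldsymbol{a}_{di}$ ($i\in\mathcal{I}$) vectors in $V$. For $t\in\mathbb{Z}_{>0}$ and $i\in\mathcal{I}$ let $P_i(t)=t\boldsymbol{a}_{1i}+t^2\boldsymbol{a}_{2i}+\cdots+t^d\boldsymbol{a}_{di}$. Suppose that (i) the cone $\mathcal{C}_d:=\langle\boldsymbol{a}_{di}\mid i\in\mathcal{I}\rangle_{\mathbb{Q}_{\geq0}}$ is a linear subspace of $V$, and (ii) for $k=d-1,d-2,\ldots,1$, the inductively defined cones $\mathcal{C}_k:=\langle\boldsymbol{a}_{ki}\mid i\in\mathcal{I}\rangle_{\mathbb{Q}_{\geq0}}+\mathcal{C}_{k+1}$ are linear subspaces of $V$. Then $\langle P_i(t)\mid i\in\mathcal{I},\,t\in\mathbb{Z}_{>0}\rangle_{\mathbb{Q}_{\geq0}}=\mathcal{C}_1$.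
   Context: For a subset $\mathcal{S}$ of a $\mathbb{Q}$-vector space, $\langle\mathcal{S}\rangle_{\mathbb{Q}_{\geq0}}$ denotes the $\mathbb{Q}_{\geq0}$-cone generated by $\mathcal{S}$: the set of all finite linear combinations of elements of $\mathcal{S}$ with non-negative rational coefficients. -}

module Defs where

open import Data.Nat as ℕ using (ℕ; zero; suc)
open import Data.Integer using (+_)
open import Data.Fin using (Fin; zero; suc; toℕ)
open import Data.Rational using (ℚ; 0ℚ; _+_; _*_; _≤_; _/_)
open import Data.List using (List; []; _∷_)
open import Data.List.Relation.Unary.All using (All)
open import Data.Product using (Σ; ∃; _×_; _,_; proj₁; proj₂)
open import Relation.Binary.PropositionalEquality using (_≡_)
open import Level using (0ℓ)
open import Relation.Unary using (Pred)

-- V = ℚ^n  (every finite-dimensional ℚ-vector space is isomorphic to one)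
Vec : ℕ → Set
Vec n = Fin n → ℚ

ℕ→ℚ : ℕ → ℚ
ℕ→ℚ k = + k / 1

0V : ∀ {n} → Vec n
0V _ = 0ℚ

_+V_ : ∀ {n} → Vec n → Vec n → Vec n
(u +V v) j = u j + v j

_·V_ : ∀ {n} → ℚ → Vec n → Vec n
(c ·V v) j = c * v j

_≈V_ : ∀ {n} → Vec n → Vec n → Set
u ≈V v = ∀ j → u j ≡ v j

sumFin : ∀ {n} (d : ℕ) → (Fin d → Vec n) → Vec n
sumFin zero f = 0V
sumFin (suc d) f = f zero +V sumFin d (λ k → f (suc k))

linComb : ∀ {n} → List (ℚ × Vec n) → Vec n
linComb [] = 0V
linComb ((c , w) ∷ l) = (c ·V w) +V linComb l

Cone : ∀ {n} → Pred (Vec n) 0ℓ → Pred (Vec n) 0ℓ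
Cone S v = Σ (List (ℚ × _)) λ l →
  All (λ cw → (0ℚ ≤ proj₁ cw) × S (proj₂ cw)) l × (v ≈V linComb l)

FamilySet : ∀ {n m} → (Fin m → Vec n) → Pred (Vec n) 0ℓ
FamilySet {m = m} f v = Σ (Fin m) λ i → v ≈V f i

_⊕_ : ∀ {n} → Pred (Vec n) 0ℓ → Pred (Vec n) 0ℓ → Pred (Vec n) 0ℓ
(S ⊕ T) v = Σ _ λ x → Σ _ λ y → S x × T y × (v ≈V (x +V y))

IsSubspace : ∀ {n} → Pred (Vec n) 0ℓ → Set
IsSubspace S = S 0V
  × (∀ x y → S x → S y → S (x +V y))
  × (∀ (c : ℚ) x → S x → S (c ·V x))

-- Families a_{k i}, k = 1..d with d = suc e, i ∈ Fin m.
-- Index k' : Fin (suc e) stands for k = toℕ k' + 1.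
-- C e a k' is the cone 𝒞_{toℕ k' + 1}:
--   𝒞_d = ⟨ a_{d i} ⟩,  𝒞_k = ⟨ a_{k i} ⟩ + 𝒞_{k+1}.
C : ∀ {n m} (e : ℕ) → (Fin (suc e) → Fin m → Vec n) → Fin (suc e) → Pred (Vec n) 0ℓ
C zero a zero = Cone (FamilySet (a zero))
C (suc e) a zero = Cone (FamilySet (a zero)) ⊕ C e (λ k → a (suc k)) zero
C (suc e) a (suc k) = C e (λ k′ → a (suc k′)) k

P : ∀ {n m} (e : ℕ) → (Fin (suc e) → Fin m → Vec n) → Fin m → ℕ → Vec n
P e a i t = sumFin (suc e) (λ k → ℕ→ℚ (t ℕ.^ suc (toℕ k)) ·V a k i)

PSet : ∀ {n m} (e : ℕ) → (Fin (suc e) → Fin m → Vec n) → Pred (Vec n) 0ℓ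
PSet {m = m} e a v = Σ (Fin m) λ i → Σ ℕ λ t → (1 ℕ.≤ t) × (v ≈V P e a i t)

{-# OPTIONS --safe #-}
-- Write P_i(t) = t Q_i(t) with Q_i(t) = Σ_k t^k a_{k+1,i}. It suffices to write every v ∈ 𝒞₁ as a
-- non-negative combination of values Q_i(t) with t ≥ 1, and by induction on d we prove more: for every T
-- there is such a representation using only times t ≥ T, with total weight bounded independently of T.
--
-- Synthetic division gives Q_i(t) = Q_i(T) + (t - T) Q′_i(t), where the quotient family Q′ has the cones
-- 𝒞₂, 𝒞₃, … again, because its coefficients differ from the a_{k+1,i} by elements of the subspaces 𝒞_{k+2}.
-- Split v - Σ_i a_{1i} ∈ 𝒞₁ as x + y with x ∈ ⟨a_{1i}⟩ and y ∈ 𝒞₂, independently of T. Then v is a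
-- non-negative combination of the Q_i(T), plus the budget Σ_i Q_i(T), plus some u ∈ 𝒞₂. By induction
-- u = Σ w Q′_i(t) with all t > T + K and Σ w ≤ K + 1, and w Q′_i(t) = w/(t - T) (Q_i(t) - Q_i(T)): the
-- subtracted terms have total weight at most 1, so the budget absorbs them.
module Submission where

open import Defs
open import Algebra.Bundles using (CommutativeRing)
open import Data.Fin using (Fin; zero; suc; toℕ)
import Data.Integer as ℤ
import Data.Integer.Properties as ℤₚ
open import Data.List using (List; []; _∷_; _++_; map; tabulate)
open import Data.List.Relation.Unary.All using (All; []; _∷_)
import Data.List.Relation.Unary.All.Properties as Allₚ
open import Data.Nat as ℕ using (ℕ; zero; suc; _∸_)
import Data.Nat.Coprimality as Coprimality
import Data.Nat.Properties as ℕₚ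
open import Data.Product using (Σ; ∃; _×_; _,_; proj₁; proj₂)
open import Data.Rational as ℚ using (ℚ; 0ℚ; 1ℚ; _+_; _*_; _-_; -_; _≤_; mkℚ; 1/_)
import Data.Rational.Properties as ℚₚ
open import Data.Rational.Solver using (module +-*-Solver)
open import Data.Unit using (tt)
open import Level using (0ℓ)
open import Relation.Binary.Definitions using (_Respects_)
open import Relation.Binary.PropositionalEquality
open import Relation.Unary using (Pred; _⊆_; _≐_)
open import Algebra.Properties.Semiring.Sum (CommutativeRing.semiring ℚₚ.+-*-commutativeRing) using (sum; ∑-distrib-+; sum-cong-≗; sum-replicate-zero)

open +-*-Solver using (solve; _:=_; _:+_; _:*_; _:-_; :-_; con)
open ≡-Reasoning

private variable n m : ℕ

0≤1 : 0ℚ ≤ 1ℚ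
0≤1 = ℚₚ.≤ᵇ⇒≤ tt

nonNeg-* : ∀ {p q} → 0ℚ ≤ p → 0ℚ ≤ q → 0ℚ ≤ p * q
nonNeg-* {p} {q} 0≤p 0≤q =
  ℚₚ.nonNegative⁻¹ _ {{ℚₚ.nonNeg*nonNeg⇒nonNeg p {{ℚ.nonNegative 0≤p}} q {{ℚ.nonNegative 0≤q}}}}

*-monoˡ-≤-0≤ : ∀ {r p q} → 0ℚ ≤ r → p ≤ q → r * p ≤ r * q
*-monoˡ-≤-0≤ {r} 0≤r = ℚₚ.*-monoˡ-≤-nonNeg r {{ℚ.nonNegative 0≤r}}

*-monoʳ-≤-0≤ : ∀ {r p q} → 0ℚ ≤ r → p ≤ q → p * r ≤ q * r
*-monoʳ-≤-0≤ {r} 0≤r = ℚₚ.*-monoʳ-≤-nonNeg r {{ℚ.nonNegative 0≤r}}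

p≤q⇒0≤q-p : ∀ {p q} → p ≤ q → 0ℚ ≤ q - p
p≤q⇒0≤q-p {p} {q} p≤q = subst (_≤ q - p) (ℚₚ.+-inverseʳ p) (ℚₚ.+-monoˡ-≤ (- p) p≤q)

0≤p⇒1-p≤1 : ∀ {p} → 0ℚ ≤ p → 1ℚ - p ≤ 1ℚ
0≤p⇒1-p≤1 0≤p = ℚₚ.+-monoʳ-≤ 1ℚ (ℚₚ.neg-antimono-≤ 0≤p)

-- ℕ→ℚ k in normal form: its numerator is a constructor, so 1/_ finds the NonZero instance for k = suc d.
ℕ→mkℚ : ℕ → ℚ
ℕ→mkℚ k = mkℚ (ℤ.+ k) 0 (Coprimality.sym (Coprimality.1-coprimeTo k))

ℕ→ℚ≡ℕ→mkℚ : ∀ k → ℕ→ℚ k ≡ ℕ→mkℚ k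
ℕ→ℚ≡ℕ→mkℚ k = ℚₚ.normalize-coprime (Coprimality.sym (Coprimality.1-coprimeTo k))

ℕ→ℚ-suc : ∀ k → ℕ→ℚ (suc k) ≡ 1ℚ + ℕ→ℚ k
ℕ→ℚ-suc k rewrite ℕ→ℚ≡ℕ→mkℚ k = cong (ℚ._/ 1) (cong (λ z → ℤ.+ 1 ℤ.+ z) (sym (ℤₚ.*-identityʳ (ℤ.+ k))))

ℕ→ℚ-+ : ∀ a b → ℕ→ℚ (a ℕ.+ b) ≡ ℕ→ℚ a + ℕ→ℚ b
ℕ→ℚ-+ zero    b = sym (ℚₚ.+-identityˡ (ℕ→ℚ b))
ℕ→ℚ-+ (suc a) b = begin
  ℕ→ℚ (suc (a ℕ.+ b))    ≡⟨ ℕ→ℚ-suc (a ℕ.+ b) ⟩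
  1ℚ + ℕ→ℚ (a ℕ.+ b)     ≡⟨ cong (1ℚ +_) (ℕ→ℚ-+ a b) ⟩
  1ℚ + (ℕ→ℚ a + ℕ→ℚ b)   ≡⟨ ℚₚ.+-assoc 1ℚ (ℕ→ℚ a) (ℕ→ℚ b) ⟨
  1ℚ + ℕ→ℚ a + ℕ→ℚ b     ≡⟨ cong (_+ ℕ→ℚ b) (ℕ→ℚ-suc a) ⟨
  ℕ→ℚ (suc a) + ℕ→ℚ b    ∎

ℕ→ℚ-* : ∀ a b → ℕ→ℚ (a ℕ.* b) ≡ ℕ→ℚ a * ℕ→ℚ b
ℕ→ℚ-* zero    b = sym (ℚₚ.*-zeroˡ (ℕ→ℚ b))
ℕ→ℚ-* (suc a) b = begin
  ℕ→ℚ (b ℕ.+ a ℕ.* b)         ≡⟨ ℕ→ℚ-+ b (a ℕ.* b) ⟩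
  ℕ→ℚ b + ℕ→ℚ (a ℕ.* b)       ≡⟨ cong (ℕ→ℚ b +_) (ℕ→ℚ-* a b) ⟩
  ℕ→ℚ b + ℕ→ℚ a * ℕ→ℚ b       ≡⟨ solve 2 (λ x y → y :+ x :* y := (con 1ℚ :+ x) :* y) refl (ℕ→ℚ a) (ℕ→ℚ b) ⟩
  (1ℚ + ℕ→ℚ a) * ℕ→ℚ b        ≡⟨ cong (_* ℕ→ℚ b) (ℕ→ℚ-suc a) ⟨
  ℕ→ℚ (suc a) * ℕ→ℚ b         ∎

ℕ→ℚ-nonNeg : ∀ k → 0ℚ ≤ ℕ→ℚ k
ℕ→ℚ-nonNeg zero    = ℚₚ.≤-refl
ℕ→ℚ-nonNeg (suc k) = subst (0ℚ ≤_) (sym (ℕ→ℚ-suc k)) (ℚₚ.+-mono-≤ 0≤1 (ℕ→ℚ-nonNeg k))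

ℕ→ℚ-mono-≤ : ∀ {a b} → a ℕ.≤ b → ℕ→ℚ a ≤ ℕ→ℚ b
ℕ→ℚ-mono-≤ {a} a≤b with ℕₚ.m≤n⇒∃[o]m+o≡n a≤b
... | c , refl = subst (ℕ→ℚ a ≤_) (sym (ℕ→ℚ-+ a c))
  (subst (_≤ ℕ→ℚ a + ℕ→ℚ c) (ℚₚ.+-identityʳ (ℕ→ℚ a)) (ℚₚ.+-monoʳ-≤ (ℕ→ℚ a) (ℕ→ℚ-nonNeg c)))

ℕ→ℚ-unbounded : ∀ q → ∃ λ K → q ≤ ℕ→ℚ K
ℕ→ℚ-unbounded q@(mkℚ (ℤ.+ a) _ _) = a , subst (q ≤_) (sym (ℕ→ℚ≡ℕ→mkℚ a))
  (ℚ.*≤* (ℤₚ.*-monoˡ-≤-nonNeg (ℤ.+ a) (ℤ.+≤+ (ℕ.s≤s ℕ.z≤n))))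
ℕ→ℚ-unbounded (mkℚ ℤ.-[1+ _ ] _ _) = 0 , ℚ.*≤* ℤ.-≤+

1/suc : ℕ → ℚ
1/suc d = 1/ ℕ→mkℚ (suc d)

ℕ→ℚ-suc-*-1/suc : ∀ d → ℕ→ℚ (suc d) * 1/suc d ≡ 1ℚ
ℕ→ℚ-suc-*-1/suc d rewrite ℕ→ℚ≡ℕ→mkℚ (suc d) = ℚₚ.*-inverseʳ (ℕ→mkℚ (suc d))

1/suc-nonNeg : ∀ d → 0ℚ ≤ 1/suc d
1/suc-nonNeg d = ℚ.*≤* (ℤ.+≤+ ℕ.z≤n)

1/suc-antimono-≤ : ∀ {d d′} → d′ ℕ.≤ d → 1/suc d ≤ 1/suc d′
1/suc-antimono-≤ d′≤d =
  ℚ.*≤* (subst₂ ℤ._≤_ (sym (ℤₚ.*-identityˡ _)) (sym (ℤₚ.*-identityˡ _)) (ℤ.+≤+ (ℕ.s≤s d′≤d)))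

sumL : {A : Set} → (A → ℚ) → List A → ℚ
sumL f []      = 0ℚ
sumL f (a ∷ l) = f a + sumL f l

module _ {A : Set} where

  sumL-*ʳ : ∀ c (f : A → ℚ) l → sumL (λ a → f a * c) l ≡ sumL f l * c
  sumL-*ʳ c f []      = sym (ℚₚ.*-zeroˡ c)
  sumL-*ʳ c f (a ∷ l) = trans (cong (f a * c +_) (sumL-*ʳ c f l)) (sym (ℚₚ.*-distribʳ-+ c (f a) (sumL f l)))

  sumL-++ : ∀ (f : A → ℚ) l l′ → sumL f (l ++ l′) ≡ sumL f l + sumL f l′
  sumL-++ f []      l′ = sym (ℚₚ.+-identityˡ _)
  sumL-++ f (a ∷ l) l′ = trans (cong (f a +_) (sumL-++ f l l′)) (sym (ℚₚ.+-assoc (f a) (sumL f l) (sumL f l′)))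

  sumL-mono-≤ : ∀ {f g : A → ℚ} {P : A → Set} → (∀ {a} → P a → f a ≤ g a) → ∀ {l} → All P l → sumL f l ≤ sumL g l
  sumL-mono-≤ f≤g []         = ℚₚ.≤-refl
  sumL-mono-≤ f≤g (pa ∷ pl) = ℚₚ.+-mono-≤ (f≤g pa) (sumL-mono-≤ f≤g pl)

  sumL-nonNeg : ∀ {f : A → ℚ} {P : A → Set} → (∀ {a} → P a → 0ℚ ≤ f a) → ∀ {l} → All P l → 0ℚ ≤ sumL f l
  sumL-nonNeg 0≤f []         = ℚₚ.≤-refl
  sumL-nonNeg 0≤f (pa ∷ pl) = ℚₚ.+-mono-≤ (0≤f pa) (sumL-nonNeg 0≤f pl)

sumL-map : {A B : Set} (f : B → ℚ) (g : A → B) (l : List A) → sumL f (map g l) ≡ sumL (λ a → f (g a)) l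
sumL-map f g []      = refl
sumL-map f g (a ∷ l) = cong (f (g a) +_) (sumL-map f g l)

sumL-tabulate : {A : Set} (f : A → ℚ) (g : Fin m → A) → sumL f (tabulate g) ≡ sum (λ i → f (g i))
sumL-tabulate {zero}  f g = refl
sumL-tabulate {suc m} f g = cong (f (g zero) +_) (sumL-tabulate f (λ i → g (suc i)))

sum-mono-≤ : {f g : Fin m → ℚ} → (∀ i → f i ≤ g i) → sum f ≤ sum g
sum-mono-≤ {zero}  f≤g = ℚₚ.≤-refl
sum-mono-≤ {suc m} f≤g = ℚₚ.+-mono-≤ (f≤g zero) (sum-mono-≤ (λ i → f≤g (suc i)))

δ : Fin m → Fin m → ℚ
δ zero    zero    = 1ℚ
δ zero    (suc _) = 0ℚ
δ (suc _) zero    = 0ℚ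
δ (suc k) (suc i) = δ k i

δ-nonNeg : (k i : Fin m) → 0ℚ ≤ δ k i
δ-nonNeg zero    zero    = 0≤1
δ-nonNeg zero    (suc _) = ℚₚ.≤-refl
δ-nonNeg (suc _) zero    = ℚₚ.≤-refl
δ-nonNeg (suc k) (suc i) = δ-nonNeg k i

δ≤1 : (k i : Fin m) → δ k i ≤ 1ℚ
δ≤1 zero    zero    = ℚₚ.≤-refl
δ≤1 zero    (suc _) = 0≤1
δ≤1 (suc _) zero    = 0≤1
δ≤1 (suc k) (suc i) = δ≤1 k i

sum-δ : ∀ (k : Fin m) (g : Fin m → ℚ) → sum (λ i → δ k i * g i) ≡ g k
sum-δ {suc m} zero g = begin
  1ℚ * g zero + sum (λ i → 0ℚ * g (suc i)) ≡⟨ cong₂ _+_ (ℚₚ.*-identityˡ (g zero)) (sum-cong-≗ (λ i → ℚₚ.*-zeroˡ (g (suc i)))) ⟩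
  g zero + sum {m} (λ _ → 0ℚ)               ≡⟨ cong (g zero +_) (sum-replicate-zero m) ⟩
  g zero + 0ℚ                               ≡⟨ ℚₚ.+-identityʳ (g zero) ⟩
  g zero                                    ∎
sum-δ {suc m} (suc k) g =
  trans (cong₂ _+_ (ℚₚ.*-zeroˡ (g zero)) (sum-δ k (λ i → g (suc i)))) (ℚₚ.+-identityˡ (g (suc k)))

-- Cones and non-negative combinations

≈V-sym : {u v : Vec n} → u ≈V v → v ≈V u
≈V-sym u≈v j = sym (u≈v j)

≈V-trans : {u v w : Vec n} → u ≈V v → v ≈V w → u ≈V w
≈V-trans u≈v v≈w j = trans (u≈v j) (v≈w j)

Cone-respects : (S : Pred (Vec n) 0ℓ) → Cone S Respects _≈V_
Cone-respects S u≈v (l , ok , u≈l) = l , ok , ≈V-trans (≈V-sym u≈v) u≈l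

Cone-0 : (S : Pred (Vec n) 0ℓ) → Cone S 0V
Cone-0 S = [] , [] , λ _ → refl

generator∈Cone : (S : Pred (Vec n) 0ℓ) → S ⊆ Cone S
generator∈Cone S {w} w∈S = (1ℚ , w) ∷ [] , (0≤1 , w∈S) ∷ [] ,
  λ j → sym (trans (ℚₚ.+-identityʳ _) (ℚₚ.*-identityˡ (w j)))

Cone-least : ∀ {S X : Pred (Vec n) 0ℓ} → IsSubspace X → X Respects _≈V_ → S ⊆ X → Cone S ⊆ X
Cone-least {S = S} {X} (0∈X , X+ , X·) X-resp S⊆X (l , ok , v≈l) = X-resp (≈V-sym v≈l) (go l ok)
  where
  go : ∀ l → All (λ cw → (0ℚ ≤ proj₁ cw) × S (proj₂ cw)) l → X (linComb l)
  go []            []              = 0∈X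
  go ((c , w) ∷ l) ((_ , w∈S) ∷ ok) = X+ _ _ (X· c w (S⊆X w∈S)) (go l ok)

⊕-respects : (S T : Pred (Vec n) 0ℓ) → (S ⊕ T) Respects _≈V_
⊕-respects S T u≈v (x , y , x∈S , y∈T , u≈x+y) = x , y , x∈S , y∈T , ≈V-trans (≈V-sym u≈v) u≈x+y

IsSubspace-resp-≐ : {S S′ : Pred (Vec n) 0ℓ} → S ≐ S′ → IsSubspace S′ → IsSubspace S
IsSubspace-resp-≐ (S⊆S′ , S′⊆S) (0∈S′ , S′+ , S′·) =
  S′⊆S 0∈S′ , (λ x y x∈S y∈S → S′⊆S (S′+ x y (S⊆S′ x∈S) (S⊆S′ y∈S))) , λ c x x∈S → S′⊆S (S′· c x (S⊆S′ x∈S))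

subspace-+· : ∀ {X : Pred (Vec n) 0ℓ} → IsSubspace X → ∀ c {y z} → X y → X z → X (y +V (c ·V z))
subspace-+· (_ , X+ , X·) c y∈X z∈X = X+ _ _ y∈X (X· c _ z∈X)

IndexList : ℕ → Set
IndexList m = List (ℚ × Fin m)

NonNeg : IndexList m → Set
NonNeg = All (λ p → 0ℚ ≤ proj₁ p)

massI : IndexList m → ℚ
massI = sumL proj₁

combination : (Fin m → Vec n) → IndexList m → Vec n
combination f L j = sumL (λ p → proj₁ p * f (proj₂ p) j) L

ones : ∀ m → IndexList m
ones m = tabulate (λ i → 1ℚ , i)

combination-++ : (f : Fin m → Vec n) (L L′ : IndexList m) → combination f (L ++ L′) ≈V (combination f L +V combination f L′)
combination-++ f L L′ j = sumL-++ (λ p → proj₁ p * f (proj₂ p) j) L L′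

combination-linear : ∀ {f g h : Fin m → Vec n} (c : ℚ) → (∀ i → f i ≈V (g i +V (c ·V h i))) →
  ∀ L → combination f L ≈V (combination g L +V (c ·V combination h L))
combination-linear c f≈ []            j = solve 1 (λ c → con 0ℚ := con 0ℚ :+ c :* con 0ℚ) refl c
combination-linear {f = f} {g} {h} c f≈ ((a , i) ∷ L) j = begin
  a * f i j + combination f L j
    ≡⟨ cong₂ (λ x y → a * x + y) (f≈ i j) (combination-linear {f = f} {g} {h} c f≈ L j) ⟩
  a * (g i j + c * h i j) + (combination g L j + c * combination h L j)
    ≡⟨ solve 6 (λ a g h c G H → a :* (g :+ c :* h) :+ (G :+ c :* H) := a :* g :+ G :+ c :* (a :* h :+ H))
             refl a (g i j) (h i j) c (combination g L j) (combination h L j) ⟩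
  a * g i j + combination g L j + c * (a * h i j + combination h L j) ∎

combination∈ : ∀ {X : Pred (Vec n) 0ℓ} {f : Fin m → Vec n} → IsSubspace X → (∀ i → X (f i)) → ∀ L → X (combination f L)
combination∈ (0∈X , _)          f∈X []            = 0∈X
combination∈ sX@(_ , X+ , X·) f∈X ((c , i) ∷ L) = X+ _ _ (X· c _ (f∈X i)) (combination∈ sX f∈X L)

Cone-FamilySet⇒combination : (f : Fin m → Vec n) → ∀ {v} → Cone (FamilySet f) v →
  Σ (IndexList m) λ L → NonNeg L × v ≈V combination f L
Cone-FamilySet⇒combination {m = m} f (l , ok , v≈l) = let L , nn , l≈L = go l ok in L , nn , ≈V-trans v≈l l≈L
  where
  go : ∀ l → All (λ cw → (0ℚ ≤ proj₁ cw) × FamilySet f (proj₂ cw)) l →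
       Σ (IndexList m) λ L → NonNeg L × linComb l ≈V combination f L
  go []            []                       = [] , [] , λ _ → refl
  go ((c , w) ∷ l) ((0≤c , i , w≈fi) ∷ ok) =
    let L , nn , l≈L = go l ok in (c , i) ∷ L , 0≤c ∷ nn , λ j → cong₂ (λ x y → c * x + y) (w≈fi j) (l≈L j)

combination∈Cone : (f : Fin m → Vec n) → ∀ {L} → NonNeg L → Cone (FamilySet f) (combination f L)
combination∈Cone f []          = [] , [] , λ _ → refl
combination∈Cone f {(c , i) ∷ L} (0≤c ∷ nn) with combination∈Cone f nn
... | l , ok , L≈l = (c , f i) ∷ l , (0≤c , i , λ _ → refl) ∷ ok , λ j → cong (c * f i j +_) (L≈l j)

weightAt : Fin m → IndexList m → ℚ
weightAt i = sumL (λ p → δ (proj₂ p) i * proj₁ p)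

weightAt-nonNeg : ∀ i {L : IndexList m} → NonNeg L → 0ℚ ≤ weightAt i L
weightAt-nonNeg i = sumL-nonNeg (λ {p} 0≤c → nonNeg-* (δ-nonNeg (proj₂ p) i) 0≤c)

weightAt≤massI : ∀ i {L : IndexList m} → NonNeg L → weightAt i L ≤ massI L
weightAt≤massI i = sumL-mono-≤ λ {p} 0≤c →
  subst (δ (proj₂ p) i * proj₁ p ≤_) (ℚₚ.*-identityˡ (proj₁ p)) (*-monoʳ-≤-0≤ 0≤c (δ≤1 (proj₂ p) i))

combination-byIndex : (f : Fin m → Vec n) (L : IndexList m) → ∀ j → combination f L j ≡ sum (λ i → weightAt i L * f i j)
combination-byIndex {m = m} f [] j = sym (trans (sum-cong-≗ (λ i → ℚₚ.*-zeroˡ (f i j))) (sum-replicate-zero m))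
combination-byIndex f ((c , k) ∷ L) j = begin
  c * f k j + combination f L j
    ≡⟨ cong₂ _+_ (sym (sum-δ k (λ i → c * f i j))) (combination-byIndex f L j) ⟩
  sum (λ i → δ k i * (c * f i j)) + sum (λ i → weightAt i L * f i j)
    ≡⟨ ∑-distrib-+ (λ i → δ k i * (c * f i j)) (λ i → weightAt i L * f i j) ⟨
  sum (λ i → δ k i * (c * f i j) + weightAt i L * f i j)
    ≡⟨ sum-cong-≗ (λ i → solve 4 (λ d c f w → d :* (c :* f) :+ w :* f := (d :* c :+ w) :* f) refl (δ k i) c (f i j) (weightAt i L)) ⟩
  sum (λ i → (δ k i * c + weightAt i L) * f i j) ∎

padding : (W : IndexList m) → NonNeg W → massI W ≤ 1ℚ → Σ (IndexList m) λ R →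
  NonNeg R × massI R ≤ massI (ones m) × (∀ (f : Fin m → Vec n) → combination f (R ++ W) ≈V combination f (ones m))
padding {m = m} {n = n} W nn W≤1 = R , R-nonNeg , R≤ones , R++W≈ones
  where
  Λ : Fin m → ℚ
  Λ i = weightAt i W
  R : IndexList m
  R = tabulate (λ i → 1ℚ - Λ i , i)
  R-nonNeg : NonNeg R
  R-nonNeg = Allₚ.tabulate⁺ (λ i → p≤q⇒0≤q-p (ℚₚ.≤-trans (weightAt≤massI i nn) W≤1))
  R≤ones : massI R ≤ massI (ones m)
  R≤ones = subst₂ _≤_ (sym (sumL-tabulate {m = m} proj₁ (λ i → 1ℚ - Λ i , i))) (sym (sumL-tabulate {m = m} proj₁ (λ i → 1ℚ , i)))
                    (sum-mono-≤ (λ i → 0≤p⇒1-p≤1 (weightAt-nonNeg i nn)))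
  R++W≈ones : ∀ f → combination f (R ++ W) ≈V combination f (ones m)
  R++W≈ones f j = begin
    combination f (R ++ W) j
      ≡⟨ combination-++ f R W j ⟩
    combination f R j + combination f W j
      ≡⟨ cong₂ _+_ (sumL-tabulate {m = m} (summand f) (λ i → 1ℚ - Λ i , i)) (combination-byIndex f W j) ⟩
    sum (λ i → (1ℚ - Λ i) * f i j) + sum (λ i → Λ i * f i j)
      ≡⟨ ∑-distrib-+ (λ i → (1ℚ - Λ i) * f i j) (λ i → Λ i * f i j) ⟨
    sum (λ i → (1ℚ - Λ i) * f i j + Λ i * f i j)
      ≡⟨ sum-cong-≗ (λ i → solve 2 (λ l f → (con 1ℚ :- l) :* f :+ l :* f := con 1ℚ :* f) refl (Λ i) (f i j)) ⟩
    sum (λ i → 1ℚ * f i j)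
      ≡⟨ sumL-tabulate {m = m} (summand f) (λ i → 1ℚ , i) ⟨
    combination f (ones m) j ∎
    where
    summand : (Fin m → Vec n) → ℚ × Fin m → ℚ
    summand f p = proj₁ p * f (proj₂ p) j

⊕-transfer : ∀ {X : Pred (Vec n) 0ℓ} {f g h : Fin m → Vec n} (c : ℚ) → IsSubspace X → (∀ i → X (h i)) →
  (∀ i → f i ≈V (g i +V (c ·V h i))) → (Cone (FamilySet f) ⊕ X) ⊆ (Cone (FamilySet g) ⊕ X)
⊕-transfer {f = f} {g} {h} c sX@(_ , X+ , X·) h∈X f≈ {v} (x , y , x∈ , y∈X , v≈x+y)
  with Cone-FamilySet⇒combination f x∈
... | L , nn , x≈ = combination g L , (c ·V combination h L) +V y , combination∈Cone g nn ,
  X+ _ _ (X· c _ (combination∈ sX h∈X L)) y∈X , λ j → begin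
    v j                                                     ≡⟨ v≈x+y j ⟩
    x j + y j                                               ≡⟨ cong (_+ y j) (≈V-trans x≈ (combination-linear {f = f} {g} {h} c f≈ L) j) ⟩
    combination g L j + c * combination h L j + y j        ≡⟨ ℚₚ.+-assoc (combination g L j) _ (y j) ⟩
    combination g L j + (c * combination h L j + y j)      ∎

C₁-respects : ∀ e (a : Fin (suc e) → Fin m → Vec n) → C e a zero Respects _≈V_
C₁-respects zero    a = Cone-respects _
C₁-respects (suc e) a = ⊕-respects _ _

0∈C₁ : ∀ e (a : Fin (suc e) → Fin m → Vec n) → C e a zero 0V
0∈C₁ zero    a = Cone-0 _
0∈C₁ (suc e) a = 0V , 0V , Cone-0 _ , 0∈C₁ e _ , λ _ → sym (ℚₚ.+-identityʳ 0ℚ)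

generator∈C₁ : ∀ e (a : Fin (suc e) → Fin m → Vec n) k i → C e a zero (a k i)
generator∈C₁ zero    a zero    i = generator∈Cone _ (i , λ _ → refl)
generator∈C₁ (suc e) a zero    i =
  a zero i , 0V , generator∈Cone _ (i , λ _ → refl) , 0∈C₁ e _ , λ _ → sym (ℚₚ.+-identityʳ _)
generator∈C₁ (suc e) a (suc k) i =
  0V , a (suc k) i , Cone-0 _ , generator∈C₁ e (λ k′ → a (suc k′)) k i , λ _ → sym (ℚₚ.+-identityˡ _)

-- Polynomials and synthetic division

horner : ∀ D → (Fin (suc D) → Vec n) → ℚ → Vec n
horner zero    c x = c zero
horner (suc D) c x = c zero +V (x ·V horner D (λ k → c (suc k)) x)

horner∈ : ∀ {X : Pred (Vec n) 0ℓ} → IsSubspace X → ∀ D (c : Fin (suc D) → Vec n) x → (∀ k → X (c k)) → X (horner D c x)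
horner∈ _                  zero    c x c∈X = c∈X zero
horner∈ sX@(_ , X+ , X·) (suc D) c x c∈X =
  X+ _ _ (c∈X zero) (X· x _ (horner∈ sX D (λ k → c (suc k)) x (λ k → c∈X (suc k))))

-- coefficients of the quotient of a polynomial by (X - T)
quotient : ∀ D → ℚ → (Fin (suc (suc D)) → Vec n) → Fin (suc D) → Vec n
quotient D       T c zero     = horner D (λ k → c (suc k)) T
quotient (suc D) T c (suc k)  = quotient D T (λ k′ → c (suc k′)) k

horner-division : ∀ D T x (c : Fin (suc (suc D)) → Vec n) →
  horner (suc D) c x ≈V (horner (suc D) c T +V ((x - T) ·V horner D (quotient D T c) x))
horner-division zero T x c j =
  solve 4 (λ c₀ c₁ x T → c₀ :+ x :* c₁ := c₀ :+ T :* c₁ :+ (x :- T) :* c₁) refl (c zero j) (c (suc zero) j) x T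
horner-division {n = n} (suc D) T x c j = begin
  c zero j + x * horner (suc D) c′ x j        ≡⟨ cong (λ z → c zero j + x * z) (horner-division D T x c′ j) ⟩
  c zero j + x * (p + (x - T) * q)            ≡⟨ solve 5 (λ c₀ x T p q → c₀ :+ x :* (p :+ (x :- T) :* q)
                                                                 := c₀ :+ T :* p :+ (x :- T) :* (p :+ x :* q))
                                                        refl (c zero j) x T p q ⟩
  c zero j + T * p + (x - T) * (p + x * q)    ∎
  where
  c′ : Fin (suc (suc D)) → Vec n
  c′ k = c (suc k)
  p q : ℚ
  p = horner (suc D) c′ T j
  q = horner D (quotient D T c′) x j

quotientFamily : ∀ D → ℚ → (Fin (suc (suc D)) → Fin m → Vec n) → Fin (suc D) → Fin m → Vec n
quotientFamily D T b k i = quotient D T (λ k′ → b k′ i) k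

C-quotientFamily : ∀ D T (b : Fin (suc (suc D)) → Fin m → Vec n) → (∀ k → IsSubspace (C (suc D) b k)) →
  ∀ k → C D (quotientFamily D T b) k ≐ C (suc D) b (suc k)
C-quotientFamily zero    T b H zero    = (λ v∈ → v∈) , (λ v∈ → v∈)
C-quotientFamily (suc D) T b H (suc k) = C-quotientFamily D T (λ k′ → b (suc k′)) (λ k′ → H (suc k′)) k
C-quotientFamily {m = m} {n = n} (suc D) T b H zero = to , from
  where
  X-sub : IsSubspace (C D (λ k → b (suc (suc k))) zero)
  X-sub = H (suc (suc zero))
  tail≐ : C D (quotientFamily D T (λ k → b (suc k))) zero ≐ C D (λ k → b (suc (suc k))) zero
  tail≐ = C-quotientFamily D T (λ k → b (suc k)) (λ k → H (suc k)) zero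
  h : Fin m → Vec n
  h i = horner D (λ k → b (suc (suc k)) i) T
  h∈X : ∀ i → C D (λ k → b (suc (suc k))) zero (h i)
  h∈X i = horner∈ X-sub D _ T (λ k → generator∈C₁ D (λ k′ → b (suc (suc k′))) k i)
  to : C (suc D) (quotientFamily (suc D) T b) zero ⊆ C (suc (suc D)) b (suc zero)
  to (x , y , x∈ , y∈ , v≈) = ⊕-transfer T X-sub h∈X (λ i j → refl) (x , y , x∈ , proj₁ tail≐ y∈ , v≈)
  from : C (suc (suc D)) b (suc zero) ⊆ C (suc D) (quotientFamily (suc D) T b) zero
  from v∈ with ⊕-transfer (- T) X-sub h∈X (λ i j → solve 3 (λ b T h → b := b :+ T :* h :+ (:- T) :* h) refl (b (suc zero) i j) T (h i j)) v∈
  ... | x , y , x∈ , y∈ , v≈ = x , y , x∈ , proj₂ tail≐ y∈ , v≈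

sumFin-cong : ∀ d {f g : Fin d → Vec n} → (∀ k → f k ≈V g k) → sumFin d f ≈V sumFin d g
sumFin-cong zero    f≈g j = refl
sumFin-cong (suc d) f≈g j = cong₂ _+_ (f≈g zero j) (sumFin-cong d (λ k → f≈g (suc k)) j)

sumFin-powers : ∀ e (c : Fin (suc e) → Vec n) t p →
  sumFin (suc e) (λ k → ℕ→ℚ (p ℕ.* t ℕ.^ toℕ k) ·V c k) ≈V (ℕ→ℚ p ·V horner e c (ℕ→ℚ t))
sumFin-powers zero c t p j =
  trans (ℚₚ.+-identityʳ _) (cong (λ z → ℕ→ℚ z * c zero j) (ℕₚ.*-identityʳ p))
sumFin-powers (suc e) c t p j = begin
  ℕ→ℚ (p ℕ.* 1) * c zero j + sumFin (suc e) (λ k → ℕ→ℚ (p ℕ.* (t ℕ.* t ℕ.^ toℕ k)) ·V c (suc k)) j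
    ≡⟨ cong₂ _+_ (cong (λ z → ℕ→ℚ z * c zero j) (ℕₚ.*-identityʳ p))
                 (sumFin-cong (suc e) (λ k j → cong (λ z → ℕ→ℚ z * c (suc k) j) (sym (ℕₚ.*-assoc p t (t ℕ.^ toℕ k)))) j) ⟩
  ℕ→ℚ p * c zero j + sumFin (suc e) (λ k → ℕ→ℚ (p ℕ.* t ℕ.* t ℕ.^ toℕ k) ·V c (suc k)) j
    ≡⟨ cong (ℕ→ℚ p * c zero j +_) (sumFin-powers e (λ k → c (suc k)) t (p ℕ.* t) j) ⟩
  ℕ→ℚ p * c zero j + ℕ→ℚ (p ℕ.* t) * H
    ≡⟨ cong (λ z → ℕ→ℚ p * c zero j + z * H) (ℕ→ℚ-* p t) ⟩
  ℕ→ℚ p * c zero j + ℕ→ℚ p * ℕ→ℚ t * H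
    ≡⟨ solve 4 (λ p c t H → p :* c :+ p :* t :* H := p :* (c :+ t :* H)) refl (ℕ→ℚ p) (c zero j) (ℕ→ℚ t) H ⟩
  ℕ→ℚ p * (c zero j + ℕ→ℚ t * H) ∎
  where
  H : ℚ
  H = horner e (λ k → c (suc k)) (ℕ→ℚ t) j

-- Representations by terms of late time and bounded mass

record Term (m : ℕ) : Set where
  constructor term
  field
    weight : ℚ
    index  : Fin m
    time   : ℕ

open Term

poly : ∀ D → (Fin (suc D) → Fin m → Vec n) → Fin m → ℚ → Vec n
poly D b i = horner D (λ k → b k i)

evalTerms : ∀ D → (Fin (suc D) → Fin m → Vec n) → List (Term m) → Vec n
evalTerms D b L j = sumL (λ x → weight x * poly D b (index x) (ℕ→ℚ (time x)) j) L

mass : List (Term m) → ℚ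
mass = sumL weight

Admissible : ℕ → List (Term m) → Set
Admissible T = All (λ x → 0ℚ ≤ weight x × T ℕ.≤ time x)

BoundedRep : ∀ D → (Fin (suc D) → Fin m → Vec n) → Pred (Vec n) 0ℓ
BoundedRep {m = m} D b v =
  Σ ℚ λ B → ∀ T → Σ (List (Term m)) λ L → Admissible T L × v ≈V evalTerms D b L × mass L ≤ B

atTime : ℕ → IndexList m → List (Term m)
atTime T = map (λ p → term (proj₁ p) (proj₂ p) T)

evalTerms-atTime : ∀ D (b : Fin (suc D) → Fin m → Vec n) T L →
  evalTerms D b (atTime T L) ≈V combination (λ i → poly D b i (ℕ→ℚ T)) L
evalTerms-atTime D b T L j = sumL-map _ _ L

mass-atTime : ∀ T (L : IndexList m) → mass (atTime T L) ≡ massI L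
mass-atTime T L = sumL-map _ _ L

atTime-admissible : ∀ T {L : IndexList m} → NonNeg L → Admissible T (atTime T L)
atTime-admissible T []         = []
atTime-admissible T (0≤c ∷ nn) = (0≤c , ℕₚ.≤-refl) ∷ atTime-admissible T nn

boundedRep-constant : (b : Fin 1 → Fin m → Vec n) → Cone (FamilySet (b zero)) ⊆ BoundedRep zero b
boundedRep-constant b v∈ with Cone-FamilySet⇒combination (b zero) v∈
... | L , nn , v≈ = massI L , λ T → atTime T L , atTime-admissible T nn ,
  ≈V-trans v≈ (≈V-sym (evalTerms-atTime zero b T L)) , ℚₚ.≤-reflexive (mass-atTime T L)

evalTerms∈Cone-PSet : ∀ e (a : Fin (suc e) → Fin m → Vec n) {L} → Admissible 1 L → Cone (PSet e a) (evalTerms e a L)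
evalTerms∈Cone-PSet e a {[]}                 []                  = [] , [] , λ _ → refl
evalTerms∈Cone-PSet e a {term w i (suc d) ∷ L} ((0≤w , _) ∷ adm) with evalTerms∈Cone-PSet e a adm
... | l , ok , L≈l = (w * 1/suc d , P e a i (suc d)) ∷ l ,
  (nonNeg-* 0≤w (1/suc-nonNeg d) , i , suc d , ℕ.s≤s ℕ.z≤n , λ _ → refl) ∷ ok ,
  λ j → cong₂ _+_ (sym (rescale j)) (L≈l j)
  where
  rescale : ∀ j → w * 1/suc d * P e a i (suc d) j ≡ w * poly e a i (ℕ→ℚ (suc d)) j
  rescale j = begin
    w * 1/suc d * P e a i (suc d) j  ≡⟨ cong (w * 1/suc d *_) (sumFin-powers e (λ k → a k i) (suc d) (suc d) j) ⟩
    w * 1/suc d * (t * p)            ≡⟨ solve 4 (λ w r t p → w :* r :* (t :* p) := w :* p :* (t :* r)) refl w (1/suc d) t p ⟩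
    w * p * (t * 1/suc d)            ≡⟨ cong (w * p *_) (ℕ→ℚ-suc-*-1/suc d) ⟩
    w * p * 1ℚ                       ≡⟨ ℚₚ.*-identityʳ (w * p) ⟩
    w * p                            ∎
    where
    t p : ℚ
    t = ℕ→ℚ (suc d)
    p = poly e a i t j

-- weight divided by time - T, for time > T
lift : ℕ → Term m → Term m
lift T x = term (weight x * 1/suc (time x ∸ suc T)) (index x) (time x)

weights : List (Term m) → IndexList m
weights = map (λ x → weight x , index x)

time-split : ∀ {T K t} → T ℕ.+ suc K ℕ.≤ t → t ≡ T ℕ.+ suc (t ∸ suc T) × K ℕ.≤ t ∸ suc T
time-split {T} {K} {t} le = sym (trans (ℕₚ.+-suc T (t ∸ suc T)) (ℕₚ.m+[n∸m]≡n (ℕₚ.≤-trans (ℕₚ.m≤m+n (suc T) K) le′))) ,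
  subst (ℕ._≤ t ∸ suc T) (ℕₚ.m+n∸m≡n (suc T) K) (ℕₚ.∸-monoˡ-≤ (suc T) le′)
  where
  le′ : suc T ℕ.+ K ℕ.≤ t
  le′ = subst (ℕ._≤ t) (ℕₚ.+-suc T K) le

lift-value : ∀ D (b : Fin (suc (suc D)) → Fin m → Vec n) T x → time x ≡ T ℕ.+ suc (time x ∸ suc T) → ∀ j →
  weight (lift T x) * poly (suc D) b (index x) (ℕ→ℚ (time x)) j
    ≡ weight (lift T x) * poly (suc D) b (index x) (ℕ→ℚ T) j + weight x * poly D (quotientFamily D (ℕ→ℚ T) b) (index x) (ℕ→ℚ (time x)) j
lift-value {n = n} D b T x t≡ j = begin
  w * r * horner (suc D) c t j              ≡⟨ cong (w * r *_) (horner-division D Tq t c j) ⟩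
  w * r * (p + (t - Tq) * q)                ≡⟨ cong (λ z → w * r * (p + z * q)) t-T≡s ⟩
  w * r * (p + s * q)                       ≡⟨ solve 5 (λ w r p s q → w :* r :* (p :+ s :* q) := w :* r :* p :+ w :* q :* (s :* r)) refl w r p s q ⟩
  w * r * p + w * q * (s * r)               ≡⟨ cong (λ z → w * r * p + w * q * z) (ℕ→ℚ-suc-*-1/suc d) ⟩
  w * r * p + w * q * 1ℚ                    ≡⟨ cong (w * r * p +_) (ℚₚ.*-identityʳ (w * q)) ⟩
  w * r * p + w * q                         ∎
  where
  d : ℕ
  d = time x ∸ suc T
  c : Fin (suc (suc D)) → Vec n
  c k = b k (index x)
  w r Tq t s p q : ℚ
  w = weight x
  r = 1/suc d
  Tq = ℕ→ℚ T
  t = ℕ→ℚ (time x)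
  s = ℕ→ℚ (suc d)
  p = horner (suc D) c Tq j
  q = horner D (quotient D Tq c) t j
  t-T≡s : t - Tq ≡ s
  t-T≡s = trans (cong (λ z → ℕ→ℚ z - Tq) t≡) (trans (cong (_- Tq) (ℕ→ℚ-+ T (suc d)))
                (solve 2 (λ a s → a :+ s :- a := s) refl Tq s))

evalTerms-lift : ∀ D (b : Fin (suc (suc D)) → Fin m → Vec n) T K {L} → Admissible (T ℕ.+ suc K) L →
  evalTerms (suc D) b (map (lift T) L)
    ≈V (combination (λ i → poly (suc D) b i (ℕ→ℚ T)) (weights (map (lift T) L)) +V evalTerms D (quotientFamily D (ℕ→ℚ T) b) L)
evalTerms-lift D b T K []                     j = sym (ℚₚ.+-identityʳ 0ℚ)
evalTerms-lift D b T K {x ∷ L} ((_ , late) ∷ adm) j = begin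
  a + evalTerms (suc D) b (map (lift T) L) j
    ≡⟨ cong₂ _+_ (lift-value D b T x (proj₁ (time-split late)) j) (evalTerms-lift D b T K adm j) ⟩
  (a′ + e) + (cL + eL)
    ≡⟨ solve 4 (λ a e c f → a :+ e :+ (c :+ f) := a :+ c :+ (e :+ f)) refl a′ e cL eL ⟩
  (a′ + cL) + (e + eL) ∎
  where
  cL eL a a′ e : ℚ
  cL = combination (λ i → poly (suc D) b i (ℕ→ℚ T)) (weights (map (lift T) L)) j
  eL = evalTerms D (quotientFamily D (ℕ→ℚ T) b) L j
  a  = weight (lift T x) * poly (suc D) b (index x) (ℕ→ℚ (time x)) j
  a′ = weight (lift T x) * poly (suc D) b (index x) (ℕ→ℚ T) j
  e  = weight x * poly D (quotientFamily D (ℕ→ℚ T) b) (index x) (ℕ→ℚ (time x)) j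

lift-admissible : ∀ T K {L : List (Term m)} → Admissible (T ℕ.+ suc K) L → Admissible T (map (lift T) L)
lift-admissible T K []                   = []
lift-admissible T K ((0≤w , late) ∷ adm) =
  (nonNeg-* 0≤w (1/suc-nonNeg _) , ℕₚ.≤-trans (ℕₚ.m≤m+n T (suc K)) late) ∷ lift-admissible T K adm

weights-nonNeg : ∀ {T} {L : List (Term m)} → Admissible T L → NonNeg (weights L)
weights-nonNeg []              = []
weights-nonNeg ((0≤w , _) ∷ adm) = 0≤w ∷ weights-nonNeg adm

massI-weights : (L : List (Term m)) → massI (weights L) ≡ mass L
massI-weights L = sumL-map proj₁ _ L

mass-lift : ∀ T K {L : List (Term m)} → Admissible (T ℕ.+ suc K) L → mass (map (lift T) L) ≤ mass L * 1/suc K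
mass-lift T K {L} adm = subst₂ _≤_ (sym (sumL-map weight (lift T) L)) (sumL-*ʳ (1/suc K) weight L)
  (sumL-mono-≤ (λ { (0≤w , late) → *-monoˡ-≤-0≤ 0≤w (1/suc-antimono-≤ (proj₂ (time-split late))) }) adm)

lifted-mass≤1 : ∀ T K {L : List (Term m)} → Admissible (T ℕ.+ suc K) L → mass L ≤ ℕ→ℚ (suc K) →
  massI (weights (map (lift T) L)) ≤ 1ℚ
lifted-mass≤1 T K {L} adm L≤K+1 = subst₂ _≤_ (sym (massI-weights (map (lift T) L))) (ℕ→ℚ-suc-*-1/suc K)
  (ℚₚ.≤-trans (mass-lift T K adm) (*-monoʳ-≤-0≤ (1/suc-nonNeg K) L≤K+1))

evalTerms-padded : ∀ D (b : Fin (suc (suc D)) → Fin m → Vec n) T K (G R : IndexList m) {L} → Admissible (T ℕ.+ suc K) L →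
  (∀ (f : Fin m → Vec n) → combination f (R ++ weights (map (lift T) L)) ≈V combination f (ones m)) →
  evalTerms (suc D) b (atTime T (G ++ R) ++ map (lift T) L)
    ≈V (combination (λ i → poly (suc D) b i (ℕ→ℚ T)) (G ++ ones m) +V evalTerms D (quotientFamily D (ℕ→ℚ T) b) L)
evalTerms-padded {m = m} {n = n} D b T K G R {L} adm R++W≈ones j = begin
  evalTerms (suc D) b (atTime T (G ++ R) ++ map (lift T) L) j
    ≡⟨ sumL-++ _ (atTime T (G ++ R)) (map (lift T) L) ⟩
  evalTerms (suc D) b (atTime T (G ++ R)) j + evalTerms (suc D) b (map (lift T) L) j
    ≡⟨ cong₂ _+_ (trans (evalTerms-atTime (suc D) b T (G ++ R) j) (combination-++ Q G R j)) (evalTerms-lift D b T K adm j) ⟩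
  (cG + combination Q R j) + (combination Q W j + eL)
    ≡⟨ solve 4 (λ g r w e → g :+ r :+ (w :+ e) := g :+ (r :+ w) :+ e) refl cG (combination Q R j) (combination Q W j) eL ⟩
  cG + (combination Q R j + combination Q W j) + eL
    ≡⟨ cong (λ z → cG + z + eL) (trans (sym (combination-++ Q R W j)) (R++W≈ones Q j)) ⟩
  cG + combination Q (ones m) j + eL
    ≡⟨ cong (_+ eL) (combination-++ Q G (ones m) j) ⟨
  combination Q (G ++ ones m) j + eL ∎
  where
  Q : Fin m → Vec n
  Q i = poly (suc D) b i (ℕ→ℚ T)
  W : IndexList m
  W = weights (map (lift T) L)
  cG eL : ℚ
  cG = combination Q G j
  eL = evalTerms D (quotientFamily D (ℕ→ℚ T) b) L j

mass-padded : ∀ T (G R : IndexList m) (L : List (Term m)) → massI R ≤ massI (ones m) → massI (weights (map (lift T) L)) ≤ 1ℚ →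
  mass (atTime T (G ++ R) ++ map (lift T) L) ≤ massI (G ++ ones m) + 1ℚ
mass-padded {m = m} T G R L R≤ones W≤1 = subst₂ _≤_ (sym lhs) (sym (cong (_+ 1ℚ) (sumL-++ proj₁ G (ones m))))
  (ℚₚ.+-mono-≤ (ℚₚ.+-monoʳ-≤ (massI G) R≤ones) W≤1)
  where
  lhs : mass (atTime T (G ++ R) ++ map (lift T) L) ≡ massI G + massI R + massI (weights (map (lift T) L))
  lhs = trans (sumL-++ weight (atTime T (G ++ R)) (map (lift T) L))
              (cong₂ _+_ (trans (mass-atTime T (G ++ R)) (sumL-++ proj₁ G R)) (sym (massI-weights (map (lift T) L))))

BudgetSplit : ∀ D → (Fin (suc (suc D)) → Fin m → Vec n) → Pred (Vec n) 0ℓ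
BudgetSplit {m = m} {n = n} D b v = Σ (IndexList m) λ G → NonNeg G ×
  Σ (Vec n) λ y → C D (λ k → b (suc k)) zero y × v ≈V (combination (b zero) (G ++ ones m) +V y)

budget-split : ∀ D (b : Fin (suc (suc D)) → Fin m → Vec n) → IsSubspace (C (suc D) b zero) → C (suc D) b zero ⊆ BudgetSplit D b
budget-split {m = m} {n = n} D b sC {v} v∈ = split (subspace-+· sC (- 1ℚ) v∈ σ∈)
  where
  σ : Vec n
  σ = combination (b zero) (ones m)
  σ∈ : C (suc D) b zero σ
  σ∈ = combination∈ sC (generator∈C₁ (suc D) b zero) (ones m)
  split : C (suc D) b zero (v +V ((- 1ℚ) ·V σ)) → BudgetSplit D b v
  split (x , y , x∈ , y∈ , v-σ≈x+y) with Cone-FamilySet⇒combination (b zero) x∈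
  ... | G , G-nonNeg , x≈ = G , G-nonNeg , y , y∈ , λ j → begin
    v j                                  ≡⟨ solve 2 (λ v s → v := v :+ (:- con 1ℚ) :* s :+ s) refl (v j) (σ j) ⟩
    v j + - 1ℚ * σ j + σ j               ≡⟨ cong (_+ σ j) (v-σ≈x+y j) ⟩
    x j + y j + σ j                      ≡⟨ cong (λ z → z + y j + σ j) (x≈ j) ⟩
    combination (b zero) G j + y j + σ j ≡⟨ solve 3 (λ a y s → a :+ y :+ s := a :+ s :+ y) refl (combination (b zero) G j) (y j) (σ j) ⟩
    combination (b zero) G j + σ j + y j ≡⟨ cong (_+ y j) (combination-++ (b zero) G (ones m) j) ⟨
    combination (b zero) (G ++ ones m) j + y j ∎

extend-representation : ∀ D (b : Fin (suc (suc D)) → Fin m → Vec n) T K (G : IndexList m) → NonNeg G →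
  ∀ {L} → Admissible (T ℕ.+ suc K) L → mass L ≤ ℕ→ℚ (suc K) →
  Σ (List (Term m)) λ L⁺ → Admissible T L⁺
    × evalTerms (suc D) b L⁺ ≈V (combination (λ i → poly (suc D) b i (ℕ→ℚ T)) (G ++ ones m) +V evalTerms D (quotientFamily D (ℕ→ℚ T) b) L)
    × mass L⁺ ≤ massI (G ++ ones m) + 1ℚ
extend-representation D b T K G G-nonNeg {L} adm L≤K+1 =
  let W≤1 = lifted-mass≤1 T K adm L≤K+1
      R , R-nonNeg , R≤ones , R++W≈ones = padding (weights (map (lift T) L)) (weights-nonNeg (lift-admissible T K adm)) W≤1
  in atTime T (G ++ R) ++ map (lift T) L ,
     Allₚ.++⁺ (atTime-admissible T (Allₚ.++⁺ G-nonNeg R-nonNeg)) (lift-admissible T K adm) ,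
     evalTerms-padded D b T K G R adm R++W≈ones ,
     mass-padded T G R L R≤ones W≤1

boundedRep-suc : ∀ D (b : Fin (suc (suc D)) → Fin m → Vec n) → (∀ k → IsSubspace (C (suc D) b k)) →
  (∀ T → C D (quotientFamily D (ℕ→ℚ T) b) zero ⊆ BoundedRep D (quotientFamily D (ℕ→ℚ T) b)) →
  BudgetSplit D b ⊆ BoundedRep (suc D) b
boundedRep-suc {m = m} {n = n} D b H IH {v} (G , G-nonNeg , y , y∈ , v≈) = massI (G ++ ones m) + 1ℚ , represent
  where
  Q h : ℕ → Fin m → Vec n
  Q T i = poly (suc D) b i (ℕ→ℚ T)
  h T i = poly D (λ k → b (suc k)) i (ℕ→ℚ T)
  u : ℕ → Vec n
  u T = y +V ((- ℕ→ℚ T) ·V combination (h T) (G ++ ones m))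
  u∈ : ∀ T → C D (quotientFamily D (ℕ→ℚ T) b) zero (u T)
  u∈ T = proj₂ (C-quotientFamily D (ℕ→ℚ T) b H zero) (subspace-+· (H (suc zero)) (- ℕ→ℚ T) y∈
    (combination∈ (H (suc zero)) (λ i → horner∈ (H (suc zero)) D _ (ℕ→ℚ T) (λ k → generator∈C₁ D _ k i)) (G ++ ones m)))
  Q+u≈v : ∀ T → (combination (Q T) (G ++ ones m) +V u T) ≈V v
  Q+u≈v T j = begin
    combination (Q T) (G ++ ones m) j + u T j
      ≡⟨ cong (_+ u T j) (combination-linear {f = Q T} {b zero} {h T} (ℕ→ℚ T) (λ i j → refl) (G ++ ones m) j) ⟩
    a + ℕ→ℚ T * c + (y j + - ℕ→ℚ T * c)
      ≡⟨ solve 4 (λ a t c y → a :+ t :* c :+ (y :+ (:- t) :* c) := a :+ y) refl a (ℕ→ℚ T) c (y j) ⟩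
    a + y j
      ≡⟨ v≈ j ⟨
    v j ∎
    where
    a c : ℚ
    a = combination (b zero) (G ++ ones m) j
    c = combination (h T) (G ++ ones m) j
  represent : ∀ T → Σ (List (Term m)) λ L → Admissible T L × v ≈V evalTerms (suc D) b L × mass L ≤ massI (G ++ ones m) + 1ℚ
  represent T =
    let Bu , reps = IH T (u∈ T)
        K , Bu≤K = ℕ→ℚ-unbounded Bu
        L , adm , u≈ , L≤Bu = reps (T ℕ.+ suc K)
        L⁺ , adm⁺ , L⁺≈ , L⁺≤ = extend-representation D b T K G G-nonNeg adm
                                  (ℚₚ.≤-trans L≤Bu (ℚₚ.≤-trans Bu≤K (ℕ→ℚ-mono-≤ (ℕₚ.n≤1+n K))))
    in L⁺ , adm⁺ , (λ j → trans (sym (Q+u≈v T j)) (trans (cong (combination (Q T) (G ++ ones m) j +_) (u≈ j)) (sym (L⁺≈ j)))) , L⁺≤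

boundedRep : ∀ D (b : Fin (suc D) → Fin m → Vec n) → (∀ k → IsSubspace (C D b k)) → C D b zero ⊆ BoundedRep D b
boundedRep zero    b H = boundedRep-constant b
boundedRep (suc D) b H v∈ = boundedRep-suc D b H
  (λ T → boundedRep D (quotientFamily D (ℕ→ℚ T) b) (λ k → IsSubspace-resp-≐ (C-quotientFamily D (ℕ→ℚ T) b H k) (H (suc k))))
  (budget-split D b (H zero) v∈)

proposition5p3 : (n m e : ℕ) → (a : Fin (suc e) → Fin m → Vec n)
    → (∀ (k : Fin (suc e)) → IsSubspace (C e a k))
    → ∀ (v : Vec n) → (Cone (PSet e a) v → C e a zero v) × (C e a zero v → Cone (PSet e a) v)
proposition5p3 n m e a H v = Cone-least (H zero) (C₁-respects e a) P∈C₁ , C₁⊆Cone-PSet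
  where
  P∈C₁ : PSet e a ⊆ C e a zero
  P∈C₁ (i , t , _ , w≈P) = C₁-respects e a (≈V-sym (≈V-trans w≈P (sumFin-powers e (λ k → a k i) t t)))
    (proj₂ (proj₂ (H zero)) (ℕ→ℚ t) _ (horner∈ (H zero) e _ (ℕ→ℚ t) (λ k → generator∈C₁ e a k i)))
  C₁⊆Cone-PSet : C e a zero v → Cone (PSet e a) v
  C₁⊆Cone-PSet v∈ with proj₂ (boundedRep e a H v∈) 1
  ... | L , adm , v≈ , _ = Cone-respects (PSet e a) (≈V-sym v≈) (evalTerms∈Cone-PSet e a adm)
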